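{- Let $G$ be a finite, simple, connected graph and let $H$ be a finite, simple, connected graph with at least two vertices. Then $\zeta(G \square H) \leq \zeta(G) + \psi(H) - 1$.
   Context: The localization game on a connected graph $G$ is played by a Cop controlling $k$ cops and a Robber. The Robber first chooses a vertex $r$, unknown to the Cop. In each turn the Cop probes a set $B=\{b_1,\dots,b_k\}$ of $k$ vertices (repetitions across turns allowed) and receives the distance vector $[d_G(r,b_1),\dots,d_G(r,b_k)]$. If the Cop can determine $r$ exactly, the Cop wins; otherwise the Robber may stay at $r$ or move to a neighbour of $r$, and the next turn begins. The Cop wins if the Robber is located after finitely many turns. The localization number $\zeta(G)$ is the least positive integer $k$ such that the Cop has a winning strategy with $k$ cops against every Robber strategy. $G \square H$ is the Cartesian product: vertex set $V(G)\times V(H)$, $(u,u')\sim(v,v')$ iff either $u=v$ and $u'v'\in E(H)$, or $u'=v'$ and $uv\in E(G)$. For a graph $H$ with at least two vertices, two vertices $v_1,v_2$ are doubly resolved by vertices $u_1,u_2$ if $d(v_1,u_1)-d(v_2,u_1)\neq d(v_1,u_2)-d(v_2,u_2)$; a set $W\subseteq V(H)$ is a doubly resolving set if every pair of distinct vertices of $H$ is doubly resolved by two vertices of $W$; $\psi(H)$ is the minimum cardinality of a doubly resolving set of $H$. -}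

module Defs where

open import Data.Nat using (ℕ; zero; suc; _≤_)
open import Data.Bool using (Bool; true; false; _∧_; _∨_; if_then_else_)
open import Data.Fin using (Fin; _≟_; remQuot)
open import Data.Fin.Subset using (Subset; _∈_; ∣_∣)
open import Data.Integer using (ℤ; +_; _-_)
open import Data.List using (List; []; _∷_; allFin)
open import Data.Bool.ListAction using (any)
open import Data.Vec using (Vec) renaming (map to vmap)
open import Data.Product using (Σ; ∃; ∃-syntax; _×_; _,_)
open import Data.Sum using (_⊎_)
open import Relation.Nullary using (¬_; does)
open import Relation.Binary.PropositionalEquality using (_≡_; _≢_)

record Graph : Set where
  constructor mkGraph
  field
    n   : ℕ
    adj : Fin n → Fin n → Bool
open Graph public

IsSimple : Graph → Set
IsSimple G = (∀ u v → adj G u v ≡ adj G v u) × (∀ u → adj G u u ≡ false)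

data Walk (G : Graph) : ℕ → Fin (n G) → Fin (n G) → Set where
  here : ∀ {u} → Walk G zero u u
  step : ∀ {k u w v} → adj G u w ≡ true → Walk G k w v → Walk G (suc k) u v

Connected : Graph → Set
Connected G = ∀ u v → ∃[ k ] Walk G k u v

reach : (G : Graph) → ℕ → Fin (n G) → Fin (n G) → Bool
reach G zero    u v = does (u ≟ v)
reach G (suc k) u v = reach G k u v ∨ any (λ w → adj G u w ∧ reach G k w v) (allFin (n G))

-- least b p = least i < b with p i = true, and b if there is none
least : ℕ → (ℕ → Bool) → ℕ
least zero    p = zero
least (suc b) p = if p zero then zero else suc (least b (λ i → p (suc i)))

-- graph distance d_G(u,v): least k with a walk of length ≤ k
-- (in a connected graph on n vertices d_G(u,v) < n)
dist : (G : Graph) → Fin (n G) → Fin (n G) → ℕ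
dist G u v = least (n G) (λ k → reach G k u v)

-- Cartesian product G □ H on Fin (n G * n H), vertex x ↦ remQuot x = (g , h)
_□_ : Graph → Graph → Graph
G □ H = mkGraph (n G Data.Nat.* n H) prodAdj
  where
  prodAdj : Fin (n G Data.Nat.* n H) → Fin (n G Data.Nat.* n H) → Bool
  prodAdj x y with remQuot {n G} (n H) x | remQuot {n G} (n H) y
  ... | (a , b) | (c , d) = (does (a ≟ c) ∧ adj H b d) ∨ (does (b ≟ d) ∧ adj G a c)

response : (G : Graph) {k : ℕ} → Vec (Fin (n G)) k → Fin (n G) → Vec ℕ k
response G B r = vmap (λ b → dist G r b) B

-- A Cop strategy: next probe as a function of all answers received so far
-- (most recent answer first).
CopStrategy : Graph → ℕ → Set
CopStrategy G k = List (Vec ℕ k) → Vec (Fin (n G)) k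

IsRobberWalk : (G : Graph) → (ℕ → Fin (n G)) → Set
IsRobberWalk G ω = ∀ i → (ω (suc i) ≡ ω i) ⊎ (adj G (ω i) (ω (suc i)) ≡ true)

-- answers received during turns 0 .. t-1
history : (G : Graph) {k : ℕ} → CopStrategy G k → (ℕ → Fin (n G)) → ℕ → List (Vec ℕ k)
history G σ ω zero    = []
history G σ ω (suc t) = response G (σ (history G σ ω t)) (ω t) ∷ history G σ ω t

Located : (G : Graph) {k : ℕ} → CopStrategy G k → (ℕ → Fin (n G)) → ℕ → Set
Located G σ ω t = ∀ ω' → IsRobberWalk G ω' →
  history G σ ω' (suc t) ≡ history G σ ω (suc t) → ω' t ≡ ω t

CopWins : Graph → ℕ → Set
CopWins G k = Σ (CopStrategy G k) λ σ →
  ∀ ω → IsRobberWalk G ω → ∃[ t ] Located G σ ω t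

IsLocalizationNumber : Graph → ℕ → Set
IsLocalizationNumber G k =
  1 ≤ k × CopWins G k × (∀ j → 1 ≤ j → j Data.Nat.< k → ¬ CopWins G j)

DoublyResolved : (H : Graph) → Fin (n H) → Fin (n H) → Fin (n H) → Fin (n H) → Set
DoublyResolved H v₁ v₂ u₁ u₂ =
  (+ dist H v₁ u₁ - + dist H v₂ u₁) ≢ (+ dist H v₁ u₂ - + dist H v₂ u₂)

IsDoublyResolving : (H : Graph) → Subset (n H) → Set
IsDoublyResolving H W = ∀ v₁ v₂ → v₁ ≢ v₂ →
  ∃[ u₁ ] ∃[ u₂ ] (u₁ ∈ W × u₂ ∈ W × DoublyResolved H v₁ v₂ u₁ u₂)

IsPsi : Graph → ℕ → Set
IsPsi H m = (∃[ W ] (IsDoublyResolving H W × ∣ W ∣ ≡ m))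
          × (∀ W → IsDoublyResolving H W → m ≤ ∣ W ∣)

module Submission where

-- In G □ H the distance is additive: d((g,h),(c,d)) = d_G(g,c) + d_H(h,d).  Fix w₁ in a
-- doubly resolving set W of H and a winning Cop strategy on G with a cops.  The Cop on G □ H
-- probes (β_i, w₁) for every probe β_i of the G-strategy, and (β₀, w) for the other w ∈ W,
-- i.e. a + |W| − 1 vertices.  Subtracting the answer at (β₀, w₁) from the answer at (β₀, w)
-- leaves d_H(h, w) − d_H(h, w₁), and these differences determine h because W is doubly
-- resolving.  Knowing h, subtracting d_H(h, w₁) from the answers at (β_i, w₁) gives exactly
-- the answers the G-strategy expects for the robber's shadow g, whose moves are robber moves
-- in G; once g is located, so is (g, h).

open import Defs
open import Data.Bool using (Bool; T; true; false; _∧_)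
open import Data.Bool.Properties using (T-∧; T-∨; T-≡; ∨-zeroʳ)
open import Data.Empty using (⊥-elim)
open import Data.Fin using (Fin; zero; suc; _≟_; toℕ; fromℕ<; quotRem; quotient; remainder; combine)
open import Data.Fin.Properties
  using (pigeonhole; toℕ≤pred[n]; toℕ-fromℕ<; remQuot-combine; combine-remQuot; any?; all?)
open import Data.Fin.Subset using (Subset; _∈_; ∣_∣; Nonempty)
open import Data.Fin.Subset.Properties using (x∈p⇒∣p-x∣<∣p∣)
open import Data.Integer using (+_; _-_; _⊖_)
open import Data.Integer.Properties using ([+m]-[+n]≡m⊖n; +-cancelˡ-⊖)
open import Data.List using (allFin; _∷_) renaming (map to mapᴸ)
open import Data.List.Membership.Propositional using (lose)
open import Data.List.Membership.Propositional.Properties using (∈-allFin)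
open import Data.List.Properties using (∷-injective)
open import Data.List.Relation.Unary.Any using (satisfied)
open import Data.List.Relation.Unary.Any.Properties using (any⁺; any⁻)
open import Data.Nat using (ℕ; zero; suc; _+_; _∸_; _≤_; _<_; z≤n; s≤s) renaming (_≟_ to _≟ℕ_)
open import Data.Nat.Induction using (<-rec)
open import Data.Nat.Properties
  using (≤-refl; ≤-trans; ≤-antisym; ≮⇒≥; m≤n⇒m≤1+n; m≤n+m; _<?_; +-monoˡ-<; +-mono-≤; m+[n∸m]≡n;
         m+n∸n≡m; +-comm; +-suc; +-cancelʳ-≡; 0≢1+n; +-commutativeSemigroup; module ≤-Reasoning)
open import Algebra.Properties.CommutativeSemigroup +-commutativeSemigroup using (xy∙z≈xz∙y; x∙yz≈yx∙z)
open import Data.Product using (∃-syntax; _×_; _,_; proj₁; proj₂; swap)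
open import Data.Sum using (_⊎_; inj₁; inj₂)
open import Data.Vec using (Vec; []; _∷_; _++_; lookup; map; take; drop; here; there)
open import Data.Vec.Properties
  using (map-++; map-∘; map-cong; lookup-map; take++drop≡id; ++-injectiveˡ; ++-injectiveʳ)
open import Function using (_∘_; Equivalence)
open import Relation.Nullary using (Dec; does; yes; no; contradiction)
open import Relation.Nullary.Decidable using (dec-true)
open import Relation.Binary.PropositionalEquality

open Equivalence using (to; from)

least-≤ : ∀ b (p : ℕ → Bool) → least b p ≤ b
least-≤ zero    p = z≤n
least-≤ (suc b) p with p zero
... | true  = z≤n
... | false = s≤s (least-≤ b (p ∘ suc))

least-minimal : ∀ b (p : ℕ → Bool) i → T (p i) → least b p ≤ i
least-minimal zero    p i       _  = z≤n
least-minimal (suc b) p i       pi with p zero in p0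
... | true = z≤n
least-minimal (suc b) p zero    pi | false = ⊥-elim (subst T p0 pi)
least-minimal (suc b) p (suc i) pi | false = s≤s (least-minimal b (p ∘ suc) i pi)

least-satisfies : ∀ b (p : ℕ → Bool) i → i < b → T (p i) → T (p (least b p))
least-satisfies zero    p i       ()  pi
least-satisfies (suc b) p i       i<b pi with p zero in p0
... | true = subst T (sym p0) _
least-satisfies (suc b) p zero    _         pi | false = ⊥-elim (subst T p0 pi)
least-satisfies (suc b) p (suc i) (s≤s i<b) pi | false = least-satisfies b (p ∘ suc) i i<b pi

module _ {G : Graph} where

  infixr 5 _++ʷ_
  _++ʷ_ : ∀ {k m u v w} → Walk G k u v → Walk G m v w → Walk G (k + m) u w
  here     ++ʷ q = q
  step e p ++ʷ q = step e (p ++ʷ q)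

  reach-complete : ∀ k {j u v} → Walk G j u v → j ≤ k → T (reach G k u v)
  reach-complete zero    {u = u} here z≤n = from T-≡ (dec-true (u ≟ u) refl)
  reach-complete (suc k) here               _         = from T-∨ (inj₁ (reach-complete k here z≤n))
  reach-complete (suc k) (step {w = w} e p) (s≤s j≤k) =
    from T-∨ (inj₂ (any⁺ _ (lose (∈-allFin w) (from T-∧ (from T-≡ e , reach-complete k p j≤k)))))

  reach-sound : ∀ k {u v} → T (reach G k u v) → ∃[ j ] (j ≤ k × Walk G j u v)
  reach-sound zero {u} {v} r with u ≟ v
  ... | yes refl = 0 , z≤n , here
  reach-sound (suc k) r with to T-∨ r
  ... | inj₁ r′ with reach-sound k r′
  ...   | j , j≤k , p = j , m≤n⇒m≤1+n j≤k , p
  reach-sound (suc k) {u} {v} r | inj₂ r′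
    with satisfied (any⁻ (λ w → adj G u w ∧ reach G k w v) (allFin (n G)) r′)
  ...   | w , e∧r with to T-∧ e∧r
  ...     | e , r″ with reach-sound k r″
  ...       | j , j≤k , p = suc j , s≤s j≤k , step (to T-≡ e) p

  dist-≤-length : ∀ {k u v} → Walk G k u v → dist G u v ≤ k
  dist-≤-length {k} {u} {v} p with k <? n G
  ... | yes k<n = least-minimal (n G) (λ j → reach G j u v) k (reach-complete k p ≤-refl)
  ... | no  k≮n = ≤-trans (least-≤ (n G) _) (≮⇒≥ k≮n)

  vertexAt : ∀ {k u v} → Walk G k u v → Fin (suc k) → Fin (n G)
  vertexAt {u = u} p          zero    = u
  vertexAt         (step e p) (suc i) = vertexAt p i

  takeʷ : ∀ {k u v} (p : Walk G k u v) i → Walk G (toℕ i) u (vertexAt p i)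
  takeʷ p          zero    = here
  takeʷ (step e p) (suc i) = step e (takeʷ p i)

  dropʷ : ∀ {k u v} (p : Walk G k u v) i → Walk G (k ∸ toℕ i) (vertexAt p i) v
  dropʷ p          zero    = p
  dropʷ (step e p) (suc i) = dropʷ p i

  shortcut : ∀ {k u v} → Walk G k u v → n G ≤ k → ∃[ j ] (j < k × Walk G j u v)
  shortcut {k} p n≤k with pigeonhole (s≤s n≤k) (vertexAt p)
  ... | i , i′ , i<i′ , same =
    toℕ i + (k ∸ toℕ i′) , shorter ,
    takeʷ p i ++ʷ subst (λ x → Walk G (k ∸ toℕ i′) x _) (sym same) (dropʷ p i′)
    where
    open ≤-Reasoning
    shorter : toℕ i + (k ∸ toℕ i′) < k
    shorter = begin-strict
      toℕ i + (k ∸ toℕ i′)  <⟨ +-monoˡ-< (k ∸ toℕ i′) i<i′ ⟩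
      toℕ i′ + (k ∸ toℕ i′) ≡⟨ m+[n∸m]≡n (toℕ≤pred[n] i′) ⟩
      k                     ∎

  shortWalk : ∀ {k u v} → Walk G k u v → ∃[ j ] (j < n G × Walk G j u v)
  shortWalk {k} = <-rec (λ k → ∀ {u v} → Walk G k u v → ∃[ j ] (j < n G × Walk G j u v)) go k
    where
    go : ∀ k → (∀ {j} → j < k → ∀ {u v} → Walk G j u v → ∃[ i ] (i < n G × Walk G i u v)) →
         ∀ {u v} → Walk G k u v → ∃[ j ] (j < n G × Walk G j u v)
    go k rec p with k <? n G
    ... | yes k<n = k , k<n , p
    ... | no  k≮n with shortcut p (≮⇒≥ k≮n)
    ...   | j , j<k , p′ = rec j<k p′

  -- `dist` only searches lengths below n G, so the walk is first shortened below n G.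
  geodesic : ∀ {k u v} → Walk G k u v → Walk G (dist G u v) u v
  geodesic {u = u} {v} p with shortWalk p
  ... | k , k<n , p′ with reach-sound (dist G u v)
                          (least-satisfies (n G) (λ j → reach G j u v) k k<n (reach-complete k p′ ≤-refl))
  ...   | j , j≤d , q = subst (λ j → Walk G j u v) (≤-antisym j≤d (dist-≤-length q)) q

≟-∧-true : ∀ {m} {i j : Fin m} {q} → does (i ≟ j) ∧ q ≡ true → i ≡ j × q ≡ true
≟-∧-true {i = i} {j} q with i ≟ j
... | yes i≡j = i≡j , q

module CartesianProduct (G H : Graph) where

  π₁ : Fin (n (G □ H)) → Fin (n G)
  π₁ = quotient (n H)

  π₂ : Fin (n (G □ H)) → Fin (n H)
  π₂ = remainder {n G} (n H)

  ⟨_,_⟩ : Fin (n G) → Fin (n H) → Fin (n (G □ H))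
  ⟨_,_⟩ = combine

  -- `_□_` inspects remQuot = swap ∘ quotRem, so quotRem is what gets abstracted and rewritten.
  □-adj⁻ : ∀ x y → adj (G □ H) x y ≡ true →
    (π₁ x ≡ π₁ y × adj H (π₂ x) (π₂ y) ≡ true) ⊎
    (π₂ x ≡ π₂ y × adj G (π₁ x) (π₁ y) ≡ true)
  □-adj⁻ x y e with quotRem {n G} (n H) x | quotRem {n G} (n H) y
  ... | b , a | d , c with does (a ≟ c) ∧ adj H b d in left
  ...   | true  = inj₁ (≟-∧-true left)
  ...   | false = inj₂ (≟-∧-true e)

  quotRem-combine : ∀ a h → quotRem {n G} (n H) ⟨ a , h ⟩ ≡ (h , a)
  quotRem-combine a h = cong swap (remQuot-combine a h)

  □-adjˡ : ∀ {a c} h → adj G a c ≡ true → adj (G □ H) ⟨ a , h ⟩ ⟨ c , h ⟩ ≡ true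
  □-adjˡ {a} {c} h e rewrite quotRem-combine a h | quotRem-combine c h | dec-true (h ≟ h) refl | e =
    ∨-zeroʳ _

  □-adjʳ : ∀ g {b d} → adj H b d ≡ true → adj (G □ H) ⟨ g , b ⟩ ⟨ g , d ⟩ ≡ true
  □-adjʳ g {b} {d} e rewrite quotRem-combine g b | quotRem-combine g d | dec-true (g ≟ g) refl | e = refl

  □-liftˡ : ∀ {k a c} → Walk G k a c → ∀ h → Walk (G □ H) k ⟨ a , h ⟩ ⟨ c , h ⟩
  □-liftˡ here       h = here
  □-liftˡ (step e p) h = step (□-adjˡ h e) (□-liftˡ p h)

  □-liftʳ : ∀ {k b d} g → Walk H k b d → Walk (G □ H) k ⟨ g , b ⟩ ⟨ g , d ⟩
  □-liftʳ g here       = here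
  □-liftʳ g (step e p) = step (□-adjʳ g e) (□-liftʳ g p)

  □-split : ∀ {k x y} → Walk (G □ H) k x y →
    ∃[ i ] ∃[ j ] (i + j ≡ k × Walk G i (π₁ x) (π₁ y) × Walk H j (π₂ x) (π₂ y))
  □-split here = 0 , 0 , refl , here , here
  □-split (step {u = x} {w = z} e p) with □-split p | □-adj⁻ x z e
  ... | i , j , i+j≡k , p₁ , p₂ | inj₁ (same₁ , e₂) =
    i , suc j , trans (+-suc i j) (cong suc i+j≡k) ,
    subst (λ a → Walk G i a _) (sym same₁) p₁ , step e₂ p₂
  ... | i , j , i+j≡k , p₁ , p₂ | inj₂ (same₂ , e₁) =
    suc i , j , cong suc i+j≡k , step e₁ p₁ , subst (λ b → Walk H j b _) (sym same₂) p₂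

  dist-□ : Connected G → Connected H → ∀ x y →
    dist (G □ H) x y ≡ dist G (π₁ x) (π₁ y) + dist H (π₂ x) (π₂ y)
  dist-□ conG conH x y = ≤-antisym (dist-≤-length via-corner) (split-≥ (□-split (geodesic via-corner)))
    where
    via-corner : Walk (G □ H) (dist G (π₁ x) (π₁ y) + dist H (π₂ x) (π₂ y)) x y
    via-corner = subst₂ (Walk (G □ H) _) (combine-remQuot {n G} (n H) x) (combine-remQuot {n G} (n H) y)
      (□-liftˡ (geodesic (proj₂ (conG (π₁ x) (π₁ y)))) (π₂ x) ++ʷ
       □-liftʳ (π₁ y) (geodesic (proj₂ (conH (π₂ x) (π₂ y)))))
    split-≥ : ∀ {k} →
      ∃[ i ] ∃[ j ] (i + j ≡ k × Walk G i (π₁ x) (π₁ y) × Walk H j (π₂ x) (π₂ y)) →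
              dist G (π₁ x) (π₁ y) + dist H (π₂ x) (π₂ y) ≤ k
    split-≥ (i , j , refl , p₁ , p₂) = +-mono-≤ (dist-≤-length p₁) (dist-≤-length p₂)

  □-robberWalk-π₁ : ∀ {ω} → IsRobberWalk (G □ H) ω → IsRobberWalk G (π₁ ∘ ω)
  □-robberWalk-π₁ {ω} moves i with moves i
  ... | inj₁ stay = inj₁ (cong π₁ stay)
  ... | inj₂ e with □-adj⁻ (ω i) (ω (suc i)) e
  ...   | inj₁ (same₁ , _) = inj₁ (sym same₁)
  ...   | inj₂ (_ , e₁)    = inj₂ e₁

  π₁-⟨⟩ : ∀ a b → π₁ ⟨ a , b ⟩ ≡ a
  π₁-⟨⟩ a b = cong proj₁ (remQuot-combine a b)

  π₂-⟨⟩ : ∀ a b → π₂ ⟨ a , b ⟩ ≡ b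
  π₂-⟨⟩ a b = cong proj₂ (remQuot-combine a b)

  dist-□-⟨⟩ : Connected G → Connected H → ∀ x c d →
    dist (G □ H) x ⟨ c , d ⟩ ≡ dist G (π₁ x) c + dist H (π₂ x) d
  dist-□-⟨⟩ conG conH x c d = trans (dist-□ conG conH x ⟨ c , d ⟩)
    (cong₂ (λ c′ d′ → dist G (π₁ x) c′ + dist H (π₂ x) d′) (π₁-⟨⟩ c d) (π₂-⟨⟩ c d))

module _ {G P : Graph} {a k : ℕ}
  (proj : Fin (n P) → Fin (n G))
  (proj-robberWalk : ∀ {ω} → IsRobberWalk P ω → IsRobberWalk G (proj ∘ ω))
  (probe : Vec (Fin (n G)) a → Vec (Fin (n P)) k)
  (decode : Vec ℕ k → Vec ℕ a)
  (decode-response : ∀ β x → decode (response P (probe β) x) ≡ response G β (proj x))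
  (response-separates : ∀ β x y → proj x ≡ proj y →
                          response P (probe β) x ≡ response P (probe β) y → x ≡ y)
  where

  simulate : CopStrategy G a → CopStrategy P k
  simulate σ = probe ∘ σ ∘ mapᴸ decode

  decode-history : ∀ σ ω t → mapᴸ decode (history P (simulate σ) ω t) ≡ history G σ (proj ∘ ω) t
  decode-history σ ω zero    = refl
  decode-history σ ω (suc t) rewrite decode-history σ ω t =
    cong (_∷ history G σ (proj ∘ ω) t) (decode-response (σ (history G σ (proj ∘ ω) t)) (ω t))

  located-simulate : ∀ σ ω t → Located G σ (proj ∘ ω) t → Located P (simulate σ) ω t
  located-simulate σ ω t locatedᴳ ω′ walk′ same =
    response-separates β (ω′ t) (ω t) same-proj same-response
    where
    β = σ (mapᴸ decode (history P (simulate σ) ω t))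
    same-proj : proj (ω′ t) ≡ proj (ω t)
    same-proj = locatedᴳ (proj ∘ ω′) (proj-robberWalk walk′)
      (trans (sym (decode-history σ ω′ (suc t)))
             (trans (cong (mapᴸ decode) same) (decode-history σ ω (suc t))))
    same-response : response P (probe β) (ω′ t) ≡ response P (probe β) (ω t)
    same-response with ∷-injective same
    ... | same-head , same-tail rewrite same-tail = same-head

  copWins-simulate : CopWins G a → CopWins P k
  copWins-simulate (σ , wins) = simulate σ , λ ω walk →
    let t , locatedᴳ = wins (proj ∘ ω) (proj-robberWalk walk) in t , located-simulate σ ω t locatedᴳ

cross-cancel : ∀ a b a′ b′ {y r} → a + r ≡ y + b → a′ + r ≡ y + b′ → a + b′ ≡ a′ + b
cross-cancel a b a′ b′ {y} {r} e e′ = +-cancelʳ-≡ r _ _ (begin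
  a + b′ + r   ≡⟨ xy∙z≈xz∙y a b′ r ⟩
  a + r + b′   ≡⟨ cong (_+ b′) e ⟩
  y + b + b′   ≡⟨ xy∙z≈xz∙y y b b′ ⟩
  y + b′ + b   ≡⟨ cong (_+ b) e′ ⟨
  a′ + r + b   ≡⟨ xy∙z≈xz∙y a′ r b ⟩
  a′ + b + r   ∎)
  where open ≡-Reasoning

cross-sum⇒-≡ : ∀ a b c d → a + d ≡ c + b → + a - + c ≡ + b - + d
cross-sum⇒-≡ a b c d e = begin
  + a - + c          ≡⟨ [+m]-[+n]≡m⊖n a c ⟩
  a ⊖ c              ≡⟨ +-cancelˡ-⊖ d a c ⟨
  (d + a) ⊖ (d + c)  ≡⟨ cong₂ _⊖_ (trans (+-comm d a) e) (+-comm d c) ⟩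
  (c + b) ⊖ (c + d)  ≡⟨ +-cancelˡ-⊖ c b d ⟩
  b ⊖ d              ≡⟨ [+m]-[+n]≡m⊖n b d ⟨
  + b - + d          ∎
  where open ≡-Reasoning

doublyResolving-injective : ∀ {H W} → IsDoublyResolving H W → ∀ {h h′} w →
  (∀ u → u ∈ W → dist H h u + dist H h′ w ≡ dist H h′ u + dist H h w) → h ≡ h′
doublyResolving-injective {H} {W} resolving {h} {h′} w same-shift with h ≟ h′
... | yes h≡h′ = h≡h′
... | no  h≢h′ with resolving h h′ h≢h′
...   | u₁ , u₂ , u₁∈W , u₂∈W , resolved =
  contradiction (trans (shift u₁ u₁∈W) (sym (shift u₂ u₂∈W))) resolved
  where
  shift : ∀ u → u ∈ W → + dist H h u - + dist H h′ u ≡ + dist H h w - + dist H h′ w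
  shift u u∈W = cross-sum⇒-≡ (dist H h u) (dist H h w) (dist H h′ u) (dist H h′ w) (same-shift u u∈W)

elements : ∀ {m} (p : Subset m) → Vec (Fin m) ∣ p ∣
elements []          = []
elements (true  ∷ p) = zero ∷ map suc (elements p)
elements (false ∷ p) = map suc (elements p)

elements-complete : ∀ {m} {p : Subset m} {x} → x ∈ p → ∃[ i ] lookup (elements p) i ≡ x
elements-complete {p = true ∷ p} here = zero , refl
elements-complete {p = true ∷ p} (there x∈p) with elements-complete x∈p
... | i , i↦x = suc i , trans (lookup-map i suc (elements p)) (cong suc i↦x)
elements-complete {p = false ∷ p} (there x∈p) with elements-complete x∈p
... | i , i↦x = i , trans (lookup-map i suc (elements p)) (cong suc i↦x)

module _ {A : Set} where

  take-++ : ∀ k (xs : Vec A k) {m} (ys : Vec A m) → take k (xs ++ ys) ≡ xs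
  take-++ k xs ys = ++-injectiveˡ (take k (xs ++ ys)) xs (take++drop≡id k (xs ++ ys))

  drop-++ : ∀ k (xs : Vec A k) {m} (ys : Vec A m) → drop k (xs ++ ys) ≡ ys
  drop-++ k xs ys = ++-injectiveʳ (take k (xs ++ ys)) xs (take++drop≡id k (xs ++ ys))

module ProductStrategy
  {G H : Graph} (conG : Connected G) (conH : Connected H)
  {W : Subset (n H)} (resolving : IsDoublyResolving H W)
  (w₁ : Fin (n H)) {m} (ws : Vec (Fin (n H)) m)
  (covers : ∀ {u} → u ∈ W → ∃[ i ] lookup (w₁ ∷ ws) i ≡ u)
  (a : ℕ)
  where

  open CartesianProduct G H

  P : Graph
  P = G □ H

  probe : Vec (Fin (n G)) (suc a) → Vec (Fin (n P)) (suc a + m)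
  probe β = map ⟨_, w₁ ⟩ β ++ map ⟨ lookup β zero ,_⟩ ws

  layerAnswers : Fin (n P) → Vec (Fin (n G)) (suc a) → Vec ℕ (suc a)
  layerAnswers x β = map (λ c → dist G (π₁ x) c + dist H (π₂ x) w₁) β

  fibreAnswers : Fin (n P) → Vec (Fin (n G)) (suc a) → Vec ℕ m
  fibreAnswers x β = map (λ w → dist G (π₁ x) (lookup β zero) + dist H (π₂ x) w) ws

  response-probe : ∀ β x → response P (probe β) x ≡ layerAnswers x β ++ fibreAnswers x β
  response-probe β x = begin
    map (dist P x) (map ⟨_, w₁ ⟩ β ++ map ⟨ lookup β zero ,_⟩ ws)
      ≡⟨ map-++ (dist P x) (map ⟨_, w₁ ⟩ β) (map ⟨ lookup β zero ,_⟩ ws) ⟩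
    map (dist P x) (map ⟨_, w₁ ⟩ β) ++ map (dist P x) (map ⟨ lookup β zero ,_⟩ ws)
      ≡⟨ cong₂ _++_
           (trans (sym (map-∘ (dist P x) ⟨_, w₁ ⟩ β)) (map-cong (λ c → dist-□-⟨⟩ conG conH x c w₁) β))
           (trans (sym (map-∘ (dist P x) ⟨ lookup β zero ,_⟩ ws))
                  (map-cong (dist-□-⟨⟩ conG conH x (lookup β zero)) ws)) ⟩
    layerAnswers x β ++ fibreAnswers x β ∎
    where open ≡-Reasoning

  -- h explains the answers r: for each w in ws, answer at (β₀, w) − answer at (β₀, w₁)
  -- equals d_H(h, w) − d_H(h, w₁), with the subtractions moved across to stay in ℕ.
  Consistent : Vec ℕ (suc a + m) → Fin (n H) → Set
  Consistent r h = ∀ i →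
    dist H h (lookup ws i) + lookup (take (suc a) r) zero ≡ lookup (drop (suc a) r) i + dist H h w₁

  consistent? : ∀ r h → Dec (Consistent r h)
  consistent? r h = all? λ i → _ ≟ℕ _

  -- The fallback w₁ is never reached on genuine answers (decodeH-response).
  decodeH : Vec ℕ (suc a + m) → Fin (n H)
  decodeH r with any? (consistent? r)
  ... | yes (h , _) = h
  ... | no _        = w₁

  decode : Vec ℕ (suc a + m) → Vec ℕ (suc a)
  decode r = map (_∸ dist H (decodeH r) w₁) (take (suc a) r)

  module _ (β : Vec (Fin (n G)) (suc a)) (x : Fin (n P)) where

    private
      r = response P (probe β) x

    take-response : take (suc a) r ≡ layerAnswers x β
    take-response =
      trans (cong (take (suc a)) (response-probe β x)) (take-++ (suc a) (layerAnswers x β) _)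

    drop-response : drop (suc a) r ≡ fibreAnswers x β
    drop-response =
      trans (cong (drop (suc a)) (response-probe β x)) (drop-++ (suc a) (layerAnswers x β) _)

    consistent-π₂ : Consistent r (π₂ x)
    consistent-π₂ i = begin
      dist H h w + lookup (take (suc a) r) zero
        ≡⟨ cong (λ t → dist H h w + lookup t zero) take-response ⟩
      dist H h w + lookup (layerAnswers x β) zero
        ≡⟨ cong (λ t → dist H h w + t) (lookup-map zero _ β) ⟩
      dist H h w + (dist G g β₀ + dist H h w₁)
        ≡⟨ x∙yz≈yx∙z (dist H h w) (dist G g β₀) (dist H h w₁) ⟩
      dist G g β₀ + dist H h w + dist H h w₁
        ≡⟨ cong (_+ dist H h w₁) (lookup-map i _ ws) ⟨
      lookup (fibreAnswers x β) i + dist H h w₁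
        ≡⟨ cong (λ t → lookup t i + dist H h w₁) drop-response ⟨
      lookup (drop (suc a) r) i + dist H h w₁
        ∎
      where
      open ≡-Reasoning
      g = π₁ x
      h = π₂ x
      w = lookup ws i
      β₀ = lookup β zero

  consistent-unique : ∀ {r h h′} → Consistent r h → Consistent r h′ → h ≡ h′
  consistent-unique {r} {h} {h′} c c′ = doublyResolving-injective resolving w₁ shift
    where
    shift : ∀ u → u ∈ W → dist H h u + dist H h′ w₁ ≡ dist H h′ u + dist H h w₁
    shift u u∈W with covers u∈W
    ... | zero  , refl = +-comm (dist H h w₁) (dist H h′ w₁)
    ... | suc i , refl =
      cross-cancel (dist H h u) (dist H h w₁) (dist H h′ u) (dist H h′ w₁) (c i) (c′ i)

  decodeH-response : ∀ β x → decodeH (response P (probe β) x) ≡ π₂ x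
  decodeH-response β x with any? (consistent? (response P (probe β) x))
  ... | yes (h , c) = consistent-unique {response P (probe β) x} c (consistent-π₂ β x)
  ... | no  ∄h      = contradiction (π₂ x , consistent-π₂ β x) ∄h

  decode-response : ∀ β x → decode (response P (probe β) x) ≡ response G β (π₁ x)
  decode-response β x = begin
    map (_∸ dist H (decodeH (response P (probe β) x)) w₁) (take (suc a) (response P (probe β) x))
      ≡⟨ cong₂ (λ h t → map (_∸ dist H h w₁) t) (decodeH-response β x) (take-response β x) ⟩
    map (_∸ dist H (π₂ x) w₁) (layerAnswers x β)
      ≡⟨ map-∘ _ _ β ⟨
    map (λ c → dist G (π₁ x) c + dist H (π₂ x) w₁ ∸ dist H (π₂ x) w₁) β
      ≡⟨ map-cong (λ c → m+n∸n≡m (dist G (π₁ x) c) (dist H (π₂ x) w₁)) β ⟩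
    response G β (π₁ x) ∎
    where open ≡-Reasoning

  response-separates : ∀ β x y → π₁ x ≡ π₁ y →
    response P (probe β) x ≡ response P (probe β) y → x ≡ y
  response-separates β x y same₁ same-response = begin
    x               ≡⟨ combine-remQuot {n G} (n H) x ⟨
    ⟨ π₁ x , π₂ x ⟩ ≡⟨ cong₂ ⟨_,_⟩ same₁ same₂ ⟩
    ⟨ π₁ y , π₂ y ⟩ ≡⟨ combine-remQuot {n G} (n H) y ⟩
    y               ∎
    where
    open ≡-Reasoning
    same₂ : π₂ x ≡ π₂ y
    same₂ = trans (sym (decodeH-response β x))
                  (trans (cong decodeH same-response) (decodeH-response β y))

  copWins-□ : CopWins G (suc a) → CopWins P (suc a + m)
  copWins-□ = copWins-simulate π₁ □-robberWalk-π₁ probe decode decode-response response-separates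

localizationNumber-≤ : ∀ {G c k} → IsLocalizationNumber G c → 1 ≤ k → CopWins G k → c ≤ k
localizationNumber-≤ (_ , _ , minimal) 1≤k wins = ≮⇒≥ (λ k<c → minimal _ 1≤k k<c wins)

doublyResolving-nonempty : ∀ {H W} → 2 ≤ n H → IsDoublyResolving H W → Nonempty W
doublyResolving-nonempty {H} 2≤n resolving with resolving (fromℕ< 0<n) (fromℕ< 2≤n) 0≢1
  where
  0<n : 0 < n H
  0<n = ≤-trans (s≤s z≤n) 2≤n
  0≢1 : fromℕ< 0<n ≢ fromℕ< 2≤n
  0≢1 e = 0≢1+n (trans (sym (toℕ-fromℕ< 0<n)) (trans (cong toℕ e) (toℕ-fromℕ< 2≤n)))
... | u , _ , u∈W , _ = u , u∈W

copWins-□-resolving : ∀ {G H W a} → Connected G → Connected H →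
  IsDoublyResolving H W → Nonempty W → CopWins G (suc a) → CopWins (G □ H) (a + ∣ W ∣)
copWins-□-resolving {G} {H} {W} {a} conG conH resolving (u , u∈W) =
  enumerated (elements W) elements-complete
  where
  enumerated : ∀ {k} (vs : Vec (Fin (n H)) k) → (∀ {u} → u ∈ W → ∃[ i ] lookup vs i ≡ u) →
               CopWins G (suc a) → CopWins (G □ H) (a + k)
  enumerated []         covers = contradiction (covers u∈W) λ ()
  enumerated (w₁ ∷ ws) covers wins =
    subst (CopWins (G □ H)) (sym (+-suc a _))
      (ProductStrategy.copWins-□ conG conH resolving w₁ ws covers a wins)

theorem4p6 : (G H : Graph) → IsSimple G → Connected G → 1 ≤ n G →
    IsSimple H → Connected H → 2 ≤ n H →
    (a b c : ℕ) → IsLocalizationNumber G a → IsPsi H b →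
    IsLocalizationNumber (G □ H) c → c ≤ a + b ∸ 1
theorem4p6 G H _ conG _ _ conH 2≤n (suc a) _ c (s≤s z≤n , wins , _) ((W , resolving , refl) , _) ζc =
  localizationNumber-≤ ζc 1≤a+∣W∣ (copWins-□-resolving conG conH resolving nonempty wins)
  where
  nonempty : Nonempty W
  nonempty = doublyResolving-nonempty 2≤n resolving
  1≤a+∣W∣ : 1 ≤ a + ∣ W ∣
  1≤a+∣W∣ = ≤-trans (s≤s z≤n) (≤-trans (x∈p⇒∣p-x∣<∣p∣ (proj₂ nonempty)) (m≤n+m ∣ W ∣ a))
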